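{- Let $\mathcal{M}$ be a finite unitary magma and $m:=\#\mathcal{M}$. Then the space of relations $\mathfrak{R}^!_{\mathrm{NC}\mathcal{M}}$ of $\mathrm{NC}\mathcal{M}^!$ satisfies $\dim\mathfrak{R}^!_{\mathrm{NC}\mathcal{M}}=2m^5-m^4$.
   Context: A unitary magma $\mathcal{M}$ is a set with binary operation $\star$ and two-sided unit $1_\mathcal{M}$. $\mathcal{T}_\mathcal{M}$ is the set of $\mathcal{M}$-triangles: triangles whose base, first edge and second edge are labeled by elements of $\mathcal{M}$; $\mathrm{T}(a,b,c)$ denotes the triangle with base label $a$, first edge label $b$, second edge label $c$. $\mathrm{Free}(\mathbb{K}\langle\mathcal{T}_\mathcal{M}\rangle)(3)$ (over a field $\mathbb{K}$ of characteristic zero) has basis the trees $x\circ_1 y$ and $x\circ_2 y$, $x,y\in\mathcal{T}_\mathcal{M}$ (grafting $y$ on the first, resp. second, leaf of $x$). $\mathfrak{R}^!_{\mathrm{NC}\mathcal{M}}$ is the subspace spanned by: (1) $\sum_{p_1\star q_0=\delta}\mathrm{T}(p_0,p_1,p_2)\circ_1\mathrm{T}(q_0,q_1,q_2)$ for $p_0,p_2,q_1,q_2\in\mathcal{M}$, $\delta\neq1_\mathcal{M}$; (2) $\sum_{p_1\star q_0=1_\mathcal{M}}\big(\mathrm{T}(p_0,p_1,p_2)\circ_1\mathrm{T}(q_0,q_1,q_2)-\mathrm{T}(p_0,q_1,p_1)\circ_2\mathrm{T}(q_0,q_2,p_2)\big)$ for $p_0,p_2,q_1,q_2\in\mathcal{M}$;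 (3) $\sum_{p_2\star q_0=\delta}\mathrm{T}(p_0,p_1,p_2)\circ_2\mathrm{T}(q_0,q_1,q_2)$ for $p_0,p_1,q_1,q_2\in\mathcal{M}$, $\delta\neq1_\mathcal{M}$ (sums over the indicated pairs in $\mathcal{M}^2$). By Proposition 4.1 of the paper this is the space of relations of the Koszul dual $\mathrm{NC}\mathcal{M}^!$ of the noncrossing clique operad $\mathrm{NC}\mathcal{M}$. -}

module Defs where

open import Level using (Level; _⊔_)
open import Data.Nat using (ℕ; zero; suc)
open import Data.Fin using (Fin)
open import Data.Fin.Properties using () renaming (_≟_ to _≟ᶠ_)
open import Data.Bool using (Bool; true; false; if_then_else_)
open import Data.Product using (_×_; _,_; Σ; ∃)
open import Data.List using (List; []; _∷_; map; concatMap; filter; allFin; foldr; length; lookup)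
open import Relation.Nullary using (¬_; Dec; yes; no)
open import Relation.Nullary.Decidable using (⌊_⌋; _×-dec_)
open import Relation.Binary.PropositionalEquality using (_≡_)
open import Algebra.Bundles using (CommutativeRing)

module _ {c ℓ : Level} (K : CommutativeRing c ℓ) where
  open CommutativeRing K

  natK : ℕ → Carrier
  natK zero    = 0#
  natK (suc n) = 1# + natK n

  record IsCharZeroField : Set (c ⊔ ℓ) where
    field
      1≉0     : ¬ (1# ≈ 0#)
      inverse : ∀ x → ¬ (x ≈ 0#) → Σ Carrier (λ y → (x * y) ≈ 1#)
      char0   : ∀ n → natK n ≈ 0# → n ≡ 0

record FiniteUnitaryMagma (m : ℕ) : Set where
  field
    _⋆_    : Fin m → Fin m → Fin m
    one    : Fin m
    identityˡ : ∀ x → (one ⋆ x) ≡ x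
    identityʳ : ∀ x → (x ⋆ one) ≡ x

module Linear {c ℓ : Level} (K : CommutativeRing c ℓ) (I : Set) where
  open CommutativeRing K

  Vect : Set c
  Vect = I → Carrier

  _≈ᵥ_ : Vect → Vect → Set ℓ
  u ≈ᵥ v = ∀ i → u i ≈ v i

  0ᵥ : Vect
  0ᵥ _ = 0#

  _+ᵥ_ : Vect → Vect → Vect
  (u +ᵥ v) i = u i + v i

  _-ᵥ_ : Vect → Vect → Vect
  (u -ᵥ v) i = u i - v i

  _·ᵥ_ : Carrier → Vect → Vect
  (a ·ᵥ v) i = a * v i

  sumᵥ : List Vect → Vect
  sumᵥ = foldr _+ᵥ_ 0ᵥ

  lincomb : ∀ {n} → (Fin n → Carrier) → (Fin n → Vect) → Vect
  lincomb {n} cs vs = sumᵥ (map (λ k → cs k ·ᵥ vs k) (allFin n))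

  InSpan : Vect → List Vect → Set (c ⊔ ℓ)
  InSpan v L = Σ (Fin (length L) → Carrier) λ cs → v ≈ᵥ lincomb cs (lookup L)

  LinIndep : ∀ {d} → (Fin d → Vect) → Set (c ⊔ ℓ)
  LinIndep {d} b = ∀ (cs : Fin d → Carrier) → lincomb cs b ≈ᵥ 0ᵥ → ∀ k → cs k ≈ 0#

  SpanHasDim : List Vect → ℕ → Set (c ⊔ ℓ)
  SpanHasDim L d = Σ (Fin d → Vect) λ b →
      (∀ k → InSpan (b k) L)
    × LinIndep b
    × (∀ j → InSpan (lookup L j) (map b (allFin d)))

module NCDual (m : ℕ) (M : FiniteUnitaryMagma m) where
  open FiniteUnitaryMagma M

  record Triangle : Set where
    constructor T
    field
      base first second : Fin m

  -- basis of Free(K<T_M>)(3): false ↦ x ∘₁ y, true ↦ x ∘₂ y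
  Tree3 : Set
  Tree3 = Bool × Triangle × Triangle

  _∘₁_ : Triangle → Triangle → Tree3
  x ∘₁ y = false , x , y

  _∘₂_ : Triangle → Triangle → Tree3
  x ∘₂ y = true , x , y

  _≟B_ : (a b : Bool) → Dec (a ≡ b)
  _≟B_ = Data.Bool._≟_
    where import Data.Bool

  _≟T_ : (x y : Triangle) → Dec (x ≡ y)
  T a b c ≟T T a' b' c' with a ≟ᶠ a' | b ≟ᶠ b' | c ≟ᶠ c'
  ... | yes Relation.Binary.PropositionalEquality.refl | yes Relation.Binary.PropositionalEquality.refl | yes Relation.Binary.PropositionalEquality.refl = yes Relation.Binary.PropositionalEquality.refl
  ... | no ne | _ | _ = no λ { Relation.Binary.PropositionalEquality.refl → ne Relation.Binary.PropositionalEquality.refl }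
  ... | yes _ | no ne | _ = no λ { Relation.Binary.PropositionalEquality.refl → ne Relation.Binary.PropositionalEquality.refl }
  ... | yes _ | yes _ | no ne = no λ { Relation.Binary.PropositionalEquality.refl → ne Relation.Binary.PropositionalEquality.refl }

  _≟3_ : (s t : Tree3) → Dec (s ≡ t)
  (b , x , y) ≟3 (b' , x' , y') with b ≟B b' | x ≟T x' | y ≟T y'
  ... | yes Relation.Binary.PropositionalEquality.refl | yes Relation.Binary.PropositionalEquality.refl | yes Relation.Binary.PropositionalEquality.refl = yes Relation.Binary.PropositionalEquality.refl
  ... | no ne | _ | _ = no λ { Relation.Binary.PropositionalEquality.refl → ne Relation.Binary.PropositionalEquality.refl }
  ... | yes _ | no ne | _ = no λ { Relation.Binary.PropositionalEquality.refl → ne Relation.Binary.PropositionalEquality.refl }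
  ... | yes _ | yes _ | no ne = no λ { Relation.Binary.PropositionalEquality.refl → ne Relation.Binary.PropositionalEquality.refl }

  elems : List (Fin m)
  elems = allFin m

  pairsWith : Fin m → List (Fin m × Fin m)
  pairsWith δ = filter (λ ab → Data.Product.proj₁ ab ⋆ Data.Product.proj₂ ab ≟ᶠ δ)
                       (concatMap (λ a → map (λ b → a , b) elems) elems)
    where import Data.Product

  quads : List (Fin m × Fin m × Fin m × Fin m)
  quads = concatMap (λ a → concatMap (λ b → concatMap (λ c → map (λ d → a , b , c , d)
            elems) elems) elems) elems

  nonUnits : List (Fin m)
  nonUnits = filter (λ δ → Relation.Nullary.Decidable.¬? (δ ≟ᶠ one)) elems

  module _ {c ℓ : Level} (K : CommutativeRing c ℓ) where
    open CommutativeRing K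
    open Linear K Tree3 public

    e : Tree3 → Vect
    e t t' with t ≟3 t'
    ... | yes _ = 1#
    ... | no  _ = 0#

    gen1 : Fin m × Fin m × Fin m × Fin m → Fin m → Vect
    gen1 (p₀ , p₂ , q₁ , q₂) δ =
      sumᵥ (map (λ { (p₁ , q₀) → e (T p₀ p₁ p₂ ∘₁ T q₀ q₁ q₂) }) (pairsWith δ))

    gen2 : Fin m × Fin m × Fin m × Fin m → Vect
    gen2 (p₀ , p₂ , q₁ , q₂) =
      sumᵥ (map (λ { (p₁ , q₀) → e (T p₀ p₁ p₂ ∘₁ T q₀ q₁ q₂) -ᵥ e (T p₀ q₁ p₁ ∘₂ T q₀ q₂ p₂) })
                (pairsWith one))

    gen3 : Fin m × Fin m × Fin m × Fin m → Fin m → Vect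
    gen3 (p₀ , p₁ , q₁ , q₂) δ =
      sumᵥ (map (λ { (p₂ , q₀) → e (T p₀ p₁ p₂ ∘₂ T q₀ q₁ q₂) }) (pairsWith δ))

    relGens : List Vect
    relGens =
         concatMap (λ q → map (gen1 q) nonUnits) quads
      Data.List.++ map gen2 quads
      Data.List.++ concatMap (λ q → map (gen3 q) nonUnits) quads
      where import Data.List

{-# OPTIONS --safe #-}

-- Write x = T(p₀,p₁,p₂), y = T(q₀,q₁,q₂). A tree x ∘₁ y occurs only in the generator of
-- type (1) or (2) indexed by (p₀,p₂,q₁,q₂) and δ = p₁ ⋆ q₀; a tree x ∘₂ y occurs only in
-- the generator of type (2) indexed by (p₀,q₂,p₁,q₁) when p₂ ⋆ q₀ = 1, and otherwise only
-- in the generator of type (3) indexed by (p₀,p₁,q₁,q₂) and δ = p₂ ⋆ q₀. So the generators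
-- have pairwise disjoint supports, and each has coefficient 1 at a tree with q₀ = 1; hence
-- they are linearly independent. They are indexed by M⁴ × (M ⊎ (M ∖ {1})), which has
-- m⁴ (2m − 1) elements. The argument works over any commutative ring.

module Submission where

open import Defs
open import Level using (Level; _⊔_)
open import Data.Nat using (ℕ; _*_; _^_; _∸_)
open import Algebra.Bundles using (CommutativeRing)

open import Data.Nat as ℕ using (suc)
open import Data.Nat.Properties using (m+n∸m≡n)
open import Data.Nat.Solver using (module +-*-Solver)
open import Data.Fin using (Fin; punchIn; punchOut)
open import Data.Fin.Properties
  using (¬Fin0; punchInᵢ≢i; punchOut-cong; punchOut-punchIn; punchIn-punchOut; *↔×; +↔⊎)
  renaming (_≟_ to _≟ᶠ_)
open import Data.Sum using (_⊎_; inj₁; inj₂)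
open import Data.Product using (_×_; _,_; proj₂; ∃; ∃₂)
open import Data.Product.Function.NonDependent.Propositional using (_×-↔_)
open import Data.Bool using (false; true)
open import Data.List using (List; []; _∷_; map; concatMap; allFin; lookup; length; _++_; cartesianProduct)
open import Data.List.Relation.Unary.Any using (here; there; index; satisfied)
open import Data.List.Relation.Unary.Any.Properties using (lookup-index)
import Data.List.Relation.Unary.All as All
open import Data.List.Relation.Unary.AllPairs using (_∷_)
open import Data.List.Relation.Unary.Unique.Propositional using (Unique)
open import Data.List.Relation.Unary.Unique.Propositional.Properties
  using (allFin⁺; filter⁺; cartesianProduct⁺)
open import Data.List.Membership.Propositional using (_∈_; lose)
open import Data.List.Membership.Propositional.Properties
  using ( ∈-map⁺; ∈-map⁻; ∈-++⁺ˡ; ∈-++⁺ʳ; ∈-++⁻; ∈-concatMap⁺; ∈-concatMap⁻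
        ; ∈-filter⁺; ∈-filter⁻; ∈-allFin; ∈-lookup)
open import Data.Empty using (⊥-elim)
open import Relation.Nullary using (yes; no; ¬?)
open import Relation.Binary.PropositionalEquality using (_≡_; _≢_; refl; sym; trans; cong; subst)
open import Function.Bundles using (_↔_; Inverse; Injection)
open import Function.Properties.Inverse using (↔⇒↣)
open import Function.Construct.Identity using (↔-id)
open import Function.Construct.Composition using (_↔-∘_)
import Algebra.Properties.Ring as RingProperties

∈-concatMap⁺′ : ∀ {a b} {A : Set a} {B : Set b} (f : A → List B) {x : A} {xs : List A} {y : B} →
                x ∈ xs → y ∈ f x → y ∈ concatMap f xs
∈-concatMap⁺′ f x∈ y∈ = ∈-concatMap⁺ f (lose x∈ y∈)

∈-concatMap-map⁺ : ∀ {a b c} {A : Set a} {B : Set b} {C : Set c} (f : A → B → C)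
                   {xs : List A} {ys : List B} {x : A} {y : B} →
                   x ∈ xs → y ∈ ys → f x y ∈ concatMap (λ x → map (f x) ys) xs
∈-concatMap-map⁺ f {ys = ys} {x = x} x∈ y∈ = ∈-concatMap⁺′ (λ x → map (f x) ys) x∈ (∈-map⁺ (f x) y∈)

∈-concatMap-map⁻ : ∀ {a b c} {A : Set a} {B : Set b} {C : Set c} (f : A → B → C)
                   {xs : List A} {ys : List B} {v : C} →
                   v ∈ concatMap (λ a → map (f a) ys) xs → ∃₂ λ a b → b ∈ ys × v ≡ f a b
∈-concatMap-map⁻ f {xs} {ys} v∈ with satisfied (∈-concatMap⁻ (λ a → map (f a) ys) {xs = xs} v∈)
... | a , v∈fa with ∈-map⁻ (f a) v∈fa
...   | b , b∈ , v≡ = a , b , b∈ , v≡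

concatMap-pairs≡cartesianProduct : ∀ {a b} {A : Set a} {B : Set b} (xs : List A) (ys : List B) →
                                   concatMap (λ a → map (a ,_) ys) xs ≡ cartesianProduct xs ys
concatMap-pairs≡cartesianProduct []       ys = refl
concatMap-pairs≡cartesianProduct (x ∷ xs) ys =
  cong (map (x ,_) ys ++_) (concatMap-pairs≡cartesianProduct xs ys)

module LinearAlgebra {c ℓ : Level} (K : CommutativeRing c ℓ) (I : Set) where
  open CommutativeRing K renaming (_*_ to _·_; refl to ≈-refl; sym to ≈-sym; trans to ≈-trans)
  open Linear K I

  sumᵥ-map-zero : ∀ {A : Set} (f : A → Vect) (xs : List A) i →
                  (∀ x → x ∈ xs → f x i ≈ 0#) → sumᵥ (map f xs) i ≈ 0#
  sumᵥ-map-zero f []       i vanish = ≈-refl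
  sumᵥ-map-zero f (x ∷ xs) i vanish =
    ≈-trans (+-cong (vanish x (here refl)) (sumᵥ-map-zero f xs i (λ y y∈ → vanish y (there y∈))))
            (+-identityʳ 0#)

  sumᵥ-map-single : ∀ {A : Set} (f : A → Vect) (xs : List A) i {a : A} → Unique xs → a ∈ xs →
                    (∀ x → x ≢ a → f x i ≈ 0#) → sumᵥ (map f xs) i ≈ f a i
  sumᵥ-map-single f (x ∷ xs) i (x∉xs ∷ _) (here refl) vanish =
    ≈-trans (+-cong ≈-refl (sumᵥ-map-zero f xs i λ y y∈ → vanish y λ { refl → All.lookup x∉xs y∈ refl }))
            (+-identityʳ _)
  sumᵥ-map-single f (x ∷ xs) i (x∉xs ∷ unique) (there a∈) vanish =
    ≈-trans (+-cong (vanish x λ { refl → All.lookup x∉xs a∈ refl }) (sumᵥ-map-single f xs i unique a∈ vanish))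
            (+-identityˡ _)

  lincomb-single : ∀ {d} (cs : Fin d → Carrier) (vs : Fin d → Vect) i (k : Fin d) →
                   (∀ j → j ≢ k → cs j · vs j i ≈ 0#) → lincomb cs vs i ≈ cs k · vs k i
  lincomb-single {d} cs vs i k =
    sumᵥ-map-single (λ j → cs j ·ᵥ vs j) (allFin d) i (allFin⁺ d) (∈-allFin k)

  indicator : ∀ {d} → Fin d → Fin d → Carrier
  indicator k j with j ≟ᶠ k
  ... | yes _ = 1#
  ... | no  _ = 0#

  ∈⇒InSpan : ∀ {v L} → v ∈ L → InSpan v L
  ∈⇒InSpan {v} {L} v∈ = indicator k , λ i → ≈-sym (begin
      lincomb (indicator k) (lookup L) i ≈⟨ lincomb-single (indicator k) (lookup L) i k (vanish-off-k i) ⟩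
      indicator k k · lookup L k i       ≈⟨ *-cong (indicator-diagonal k) ≈-refl ⟩
      1# · lookup L k i                  ≈⟨ *-identityˡ _ ⟩
      lookup L k i                       ≡⟨ cong (λ w → w i) (sym (lookup-index v∈)) ⟩
      v i                                ∎)
    where
      open import Relation.Binary.Reasoning.Setoid setoid
      k : Fin (length L)
      k = index v∈
      indicator-diagonal : ∀ j → indicator j j ≈ 1#
      indicator-diagonal j with j ≟ᶠ j
      ... | yes _  = ≈-refl
      ... | no j≢j = ⊥-elim (j≢j refl)
      vanish-off-k : ∀ i j → j ≢ k → indicator k j · lookup L j i ≈ 0#
      vanish-off-k i j j≢k with j ≟ᶠ k
      ... | yes j≡k = ⊥-elim (j≢k j≡k)
      ... | no  _   = zeroˡ _

  biorthogonal⇒LinIndep : ∀ {d} (b : Fin d → Vect) (w : Fin d → I) →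
                          (∀ k → b k (w k) ≈ 1#) → (∀ j k → j ≢ k → b j (w k) ≈ 0#) → LinIndep b
  biorthogonal⇒LinIndep b w diagonal off-diagonal cs cs·b≈0 k = begin
      cs k               ≈⟨ *-identityʳ _ ⟨
      cs k · 1#          ≈⟨ *-cong ≈-refl (diagonal k) ⟨
      cs k · b k (w k)   ≈⟨ lincomb-single cs b (w k) k vanish-off-k ⟨
      lincomb cs b (w k) ≈⟨ cs·b≈0 (w k) ⟩
      0#                 ∎
    where
      open import Relation.Binary.Reasoning.Setoid setoid
      vanish-off-k : ∀ j → j ≢ k → cs j · b j (w k) ≈ 0#
      vanish-off-k j j≢k = ≈-trans (*-cong ≈-refl (off-diagonal j k j≢k)) (zeroʳ _)

  record SupportedOnFibres {C : Set} (g : C → Vect) (label : I → C) : Set (c ⊔ ℓ) where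
    field
      witness         : C → I
      label-witness   : ∀ γ → label (witness γ) ≡ γ
      vanish-offFibre : ∀ γ i → label i ≢ γ → g γ i ≈ 0#
      one-at-witness  : ∀ γ → g γ (witness γ) ≈ 1#

  supportedOnFibres⇒SpanHasDim : ∀ {d} {C : Set} {g : C → Vect} {label : I → C} (L : List Vect) →
                                 SupportedOnFibres g label → Fin d ↔ C →
                                 (∀ γ → g γ ∈ L) → (∀ v → v ∈ L → ∃ λ γ → v ≡ g γ) → SpanHasDim L d
  supportedOnFibres⇒SpanHasDim {d} {g = g} L supported enumeration g∈L L⊆g =
      b , (λ k → ∈⇒InSpan (g∈L (to k))) , independent , λ j → ∈⇒InSpan (L⊆b (∈-lookup j))
    where
      open SupportedOnFibres supported
      open Inverse enumeration using (to; from; strictlyInverseˡ)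
      open Injection (↔⇒↣ enumeration) using (injective)
      b : Fin d → Vect
      b k = g (to k)
      independent : LinIndep b
      independent = biorthogonal⇒LinIndep b (λ k → witness (to k)) (λ k → one-at-witness (to k))
        (λ j k j≢k → vanish-offFibre (to j) (witness (to k))
          (λ label≡ → j≢k (injective (trans (sym label≡) (label-witness (to k))))))
      L⊆b : ∀ {v} → v ∈ L → v ∈ map b (allFin d)
      L⊆b v∈ with L⊆g _ v∈
      ... | γ , refl =
        subst (_∈ map b (allFin d)) (cong g (strictlyInverseˡ γ)) (∈-map⁺ b (∈-allFin (from γ)))

module Relations {n : ℕ} (M : FiniteUnitaryMagma (suc n)) where
  open FiniteUnitaryMagma M
  open NCDual (suc n) M using (T; Tree3; _∘₁_; _∘₂_; pairsWith; quads; nonUnits; elems)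

  m : ℕ
  m = suc n

  Quad : Set
  Quad = Fin m × Fin m × Fin m × Fin m

  -- (q , inj₁ δ) indexes generator (1) if δ ≠ 1 and generator (2) if δ = 1;
  -- (q , inj₂ x) indexes generator (3) with δ = punchIn one x, which ranges over δ ≠ 1.
  Code : Set
  Code = Quad × (Fin m ⊎ Fin n)

  code↔ : Fin (m * (m * (m * m)) * (m ℕ.+ n)) ↔ Code
  code↔ = (quad↔ ×-↔ +↔⊎) ↔-∘ *↔×
    where
      quad↔ : Fin (m * (m * (m * m))) ↔ Quad
      quad↔ = (↔-id _ ×-↔ (↔-id _ ×-↔ *↔×)) ↔-∘ ((↔-id _ ×-↔ *↔×) ↔-∘ *↔×)

  dimension≡#Code : 2 * m ^ 5 ∸ m ^ 4 ≡ m * (m * (m * m)) * (m ℕ.+ n)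
  dimension≡#Code = trans (cong (_∸ m ^ 4) twice-m⁵) (m+n∸m≡n (m ^ 4) _)
    where
      open +-*-Solver
      twice-m⁵ : 2 * m ^ 5 ≡ m ^ 4 ℕ.+ m * (m * (m * m)) * (m ℕ.+ n)
      twice-m⁵ = solve 1 (λ x → con 2 :* ((con 1 :+ x) :^ 5) :=
                   ((con 1 :+ x) :^ 4) :+ (con 1 :+ x) :* ((con 1 :+ x) :* ((con 1 :+ x) :* (con 1 :+ x)))
                                          :* ((con 1 :+ x) :+ x)) refl n

  nonunitIndex : ∀ {δ} → δ ≢ one → Fin n
  nonunitIndex ≢one = punchOut (λ one≡ → ≢one (sym one≡))

  -- the index of the only generator whose support contains the tree
  label : Tree3 → Code
  label (false , T p₀ p₁ p₂ , T q₀ q₁ q₂) = (p₀ , p₂ , q₁ , q₂) , inj₁ (p₁ ⋆ q₀)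
  label (true  , T p₀ p₁ p₂ , T q₀ q₁ q₂) with p₂ ⋆ q₀ ≟ᶠ one
  ... | yes _    = (p₀ , q₂ , p₁ , q₁) , inj₁ one
  ... | no  ≢one = (p₀ , p₁ , q₁ , q₂) , inj₂ (nonunitIndex ≢one)

  label-∘₁ : ∀ {p₀ p₁ p₂ q₀ q₁ q₂ δ} → p₁ ⋆ q₀ ≡ δ →
             label (T p₀ p₁ p₂ ∘₁ T q₀ q₁ q₂) ≡ ((p₀ , p₂ , q₁ , q₂) , inj₁ δ)
  label-∘₁ = cong (λ δ → _ , inj₁ δ)

  label-∘₂-unit : ∀ {p₀ p₁ p₂ q₀ q₁ q₂} → p₂ ⋆ q₀ ≡ one →
                  label (T p₀ p₁ p₂ ∘₂ T q₀ q₁ q₂) ≡ ((p₀ , q₂ , p₁ , q₁) , inj₁ one)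
  label-∘₂-unit {p₂ = p₂} {q₀} ≡one with p₂ ⋆ q₀ ≟ᶠ one
  ... | yes _    = refl
  ... | no  ≢one = ⊥-elim (≢one ≡one)

  label-∘₂-nonunit : ∀ {p₀ p₁ p₂ q₀ q₁ q₂} x → p₂ ⋆ q₀ ≡ punchIn one x →
                     label (T p₀ p₁ p₂ ∘₂ T q₀ q₁ q₂) ≡ ((p₀ , p₁ , q₁ , q₂) , inj₂ x)
  label-∘₂-nonunit {p₂ = p₂} {q₀} x ≡δ with p₂ ⋆ q₀ ≟ᶠ one
  ... | yes ≡one = ⊥-elim (punchInᵢ≢i one x (trans (sym ≡δ) ≡one))
  ... | no  _    = cong (λ y → _ , inj₂ y) (trans (punchOut-cong one ≡δ) (punchOut-punchIn one))

  witness : Code → Tree3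
  witness ((p₀ , p₂ , q₁ , q₂) , inj₁ δ) = T p₀ δ p₂ ∘₁ T one q₁ q₂
  witness ((p₀ , p₁ , q₁ , q₂) , inj₂ x) = T p₀ p₁ (punchIn one x) ∘₂ T one q₁ q₂

  label-witness : ∀ γ → label (witness γ) ≡ γ
  label-witness (q , inj₁ δ) = label-∘₁ (identityʳ δ)
  label-witness (q , inj₂ x) = label-∘₂-nonunit x (identityʳ _)

  ∈-pairsWith⁺ : ∀ {δ a b} → a ⋆ b ≡ δ → (a , b) ∈ pairsWith δ
  ∈-pairsWith⁺ {δ} {a} {b} ≡δ = ∈-filter⁺ (λ (a , b) → a ⋆ b ≟ᶠ δ)
    (∈-concatMap-map⁺ _,_ (∈-allFin a) (∈-allFin b)) ≡δ

  ∈-pairsWith⁻ : ∀ {δ a b} → (a , b) ∈ pairsWith δ → a ⋆ b ≡ δ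
  ∈-pairsWith⁻ {δ} ab∈ = proj₂ (∈-filter⁻ (λ (a , b) → a ⋆ b ≟ᶠ δ) ab∈)

  pairsWith-unique : ∀ δ → Unique (pairsWith δ)
  pairsWith-unique δ = filter⁺ (λ (a , b) → a ⋆ b ≟ᶠ δ)
    (subst Unique (sym (concatMap-pairs≡cartesianProduct elems elems))
           (cartesianProduct⁺ (allFin⁺ m) (allFin⁺ m)))

  ∈-quads : ∀ q → q ∈ quads
  ∈-quads (a , b , c , d) =
    ∈-concatMap⁺′ byFirst (∈-allFin a) (∈-concatMap⁺′ (bySecond a) (∈-allFin b)
      (∈-concatMap-map⁺ (λ c d → a , b , c , d) (∈-allFin c) (∈-allFin d)))
    where
      bySecond : Fin m → Fin m → List Quad
      bySecond a b = concatMap (λ c → map (λ d → a , b , c , d) elems) elems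
      byFirst : Fin m → List Quad
      byFirst a = concatMap (bySecond a) elems

  ∈-nonUnits⁺ : ∀ {δ} → δ ≢ one → δ ∈ nonUnits
  ∈-nonUnits⁺ {δ} = ∈-filter⁺ (λ δ → ¬? (δ ≟ᶠ one)) (∈-allFin δ)

  ∈-nonUnits⁻ : ∀ {δ} → δ ∈ nonUnits → δ ≢ one
  ∈-nonUnits⁻ δ∈ = proj₂ (∈-filter⁻ (λ δ → ¬? (δ ≟ᶠ one)) {xs = elems} δ∈)

  module Generators {c ℓ : Level} (K : CommutativeRing c ℓ) where
    open CommutativeRing K renaming (refl to ≈-refl; sym to ≈-sym; trans to ≈-trans)
    open Linear K Tree3
    open RingProperties ring using (-0#≈0#)
    open LinearAlgebra K Tree3 using (sumᵥ-map-zero; sumᵥ-map-single; SupportedOnFibres)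
    open NCDual (suc n) M using (_≟3_; e; gen1; gen2; gen3; relGens)

    x-y≈x : ∀ {x y} → y ≈ 0# → x - y ≈ x
    x-y≈x y≈0 = ≈-trans (+-cong ≈-refl (≈-trans (-‿cong y≈0) -0#≈0#)) (+-identityʳ _)

    gen : Code → Vect
    gen (q , inj₁ δ) with δ ≟ᶠ one
    ... | yes _ = gen2 K q
    ... | no  _ = gen1 K q δ
    gen (q , inj₂ x) = gen3 K q (punchIn one x)

    gen-unit : ∀ q → gen (q , inj₁ one) ≡ gen2 K q
    gen-unit q with one ≟ᶠ one
    ... | yes _    = refl
    ... | no  ≢one = ⊥-elim (≢one refl)

    gen-nonunit : ∀ q {δ} → δ ≢ one → gen (q , inj₁ δ) ≡ gen1 K q δ
    gen-nonunit q {δ} ≢one with δ ≟ᶠ one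
    ... | yes ≡one = ⊥-elim (≢one ≡one)
    ... | no  _    = refl

    e-diagonal : ∀ t → e K t t ≈ 1#
    e-diagonal t with t ≟3 t
    ... | yes _  = ≈-refl
    ... | no t≢t = ⊥-elim (t≢t refl)

    e-offDiagonal : ∀ s t → s ≢ t → e K s t ≈ 0#
    e-offDiagonal s t s≢t with s ≟3 t
    ... | yes s≡t = ⊥-elim (s≢t s≡t)
    ... | no  _   = ≈-refl

    e-offFibre : ∀ s t {γ} → label s ≡ γ → label t ≢ γ → e K s t ≈ 0#
    e-offFibre s t ≡γ ≢γ = e-offDiagonal s t (λ { refl → ≢γ ≡γ })

    gen-vanish-offFibre : ∀ γ t → label t ≢ γ → gen γ t ≈ 0#
    gen-vanish-offFibre ((p₀ , p₂ , q₁ , q₂) , inj₁ δ) t ≢γ with δ ≟ᶠ one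
    ... | yes refl = sumᵥ-map-zero _ (pairsWith one) t λ (p₁ , q₀) p₁q₀∈ →
      ≈-trans (x-y≈x (e-offFibre (T p₀ q₁ p₁ ∘₂ T q₀ q₂ p₂) t (label-∘₂-unit (∈-pairsWith⁻ p₁q₀∈)) ≢γ))
              (e-offFibre (T p₀ p₁ p₂ ∘₁ T q₀ q₁ q₂) t (label-∘₁ (∈-pairsWith⁻ p₁q₀∈)) ≢γ)
    ... | no  _    = sumᵥ-map-zero _ (pairsWith δ) t λ (p₁ , q₀) p₁q₀∈ →
      e-offFibre (T p₀ p₁ p₂ ∘₁ T q₀ q₁ q₂) t (label-∘₁ (∈-pairsWith⁻ p₁q₀∈)) ≢γ
    gen-vanish-offFibre ((p₀ , p₁ , q₁ , q₂) , inj₂ x) t ≢γ =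
      sumᵥ-map-zero _ (pairsWith (punchIn one x)) t λ (p₂ , q₀) p₂q₀∈ →
        e-offFibre (T p₀ p₁ p₂ ∘₂ T q₀ q₁ q₂) t (label-∘₂-nonunit x (∈-pairsWith⁻ p₂q₀∈)) ≢γ

    gen-one-at-witness : ∀ γ → gen γ (witness γ) ≈ 1#
    gen-one-at-witness γ@((p₀ , p₂ , q₁ , q₂) , inj₁ δ) with δ ≟ᶠ one
    ... | yes refl = ≈-trans
      (sumᵥ-map-single _ (pairsWith one) (witness γ) (pairsWith-unique one) (∈-pairsWith⁺ (identityʳ one))
        λ (p₁ , q₀) ≢pair →
          ≈-trans (x-y≈x (e-offDiagonal (T p₀ q₁ p₁ ∘₂ T q₀ q₂ p₂) (witness γ) (λ ())))
                  (e-offDiagonal (T p₀ p₁ p₂ ∘₁ T q₀ q₁ q₂) (witness γ) (λ { refl → ≢pair refl })))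
      (≈-trans (x-y≈x (e-offDiagonal (T p₀ q₁ one ∘₂ T one q₂ p₂) (witness γ) (λ ())))
               (e-diagonal (witness γ)))
    ... | no  _    = ≈-trans
      (sumᵥ-map-single _ (pairsWith δ) (witness γ) (pairsWith-unique δ) (∈-pairsWith⁺ (identityʳ δ))
        λ (p₁ , q₀) ≢pair →
          e-offDiagonal (T p₀ p₁ p₂ ∘₁ T q₀ q₁ q₂) (witness γ) (λ { refl → ≢pair refl }))
      (e-diagonal (witness γ))
    gen-one-at-witness γ@((p₀ , p₁ , q₁ , q₂) , inj₂ x) = ≈-trans
      (sumᵥ-map-single _ (pairsWith (punchIn one x)) (witness γ) (pairsWith-unique _) (∈-pairsWith⁺ (identityʳ _))
        λ (p₂ , q₀) ≢pair →
          e-offDiagonal (T p₀ p₁ p₂ ∘₂ T q₀ q₁ q₂) (witness γ) (λ { refl → ≢pair refl }))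
      (e-diagonal (witness γ))

    gen-supportedOnFibres : SupportedOnFibres gen label
    gen-supportedOnFibres = record
      { witness         = witness
      ; label-witness   = label-witness
      ; vanish-offFibre = gen-vanish-offFibre
      ; one-at-witness  = gen-one-at-witness
      }

    generators₁ generators₂ : List Vect
    generators₁ = concatMap (λ q → map (gen1 K q) nonUnits) quads
    generators₂ = map (gen2 K) quads

    gen∈relGens : ∀ γ → gen γ ∈ relGens K
    gen∈relGens (q , inj₁ δ) with δ ≟ᶠ one
    ... | yes _    = ∈-++⁺ʳ generators₁ (∈-++⁺ˡ (∈-map⁺ (gen2 K) (∈-quads q)))
    ... | no  ≢one = ∈-++⁺ˡ (∈-concatMap-map⁺ (gen1 K) (∈-quads q) (∈-nonUnits⁺ ≢one))
    gen∈relGens (q , inj₂ x) = ∈-++⁺ʳ generators₁ (∈-++⁺ʳ generators₂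
      (∈-concatMap-map⁺ (gen3 K) (∈-quads q) (∈-nonUnits⁺ (punchInᵢ≢i one x))))

    relGens⊆gen : ∀ v → v ∈ relGens K → ∃ λ γ → v ≡ gen γ
    relGens⊆gen v v∈ with ∈-++⁻ generators₁ v∈
    ... | inj₁ v∈₁ with ∈-concatMap-map⁻ (gen1 K) {xs = quads} v∈₁
    ...   | q , δ , δ∈ , refl = (q , inj₁ δ) , sym (gen-nonunit q (∈-nonUnits⁻ δ∈))
    relGens⊆gen v v∈ | inj₂ v∈₂₃ with ∈-++⁻ generators₂ v∈₂₃
    ... | inj₁ v∈₂ with ∈-map⁻ (gen2 K) v∈₂
    ...   | q , _ , refl = (q , inj₁ one) , sym (gen-unit q)
    relGens⊆gen v v∈ | inj₂ v∈₂₃ | inj₂ v∈₃ with ∈-concatMap-map⁻ (gen3 K) {xs = quads} v∈₃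
    ...   | q , δ , δ∈ , refl =
      (q , inj₂ (nonunitIndex (∈-nonUnits⁻ δ∈))) , cong (gen3 K q) (sym (punchIn-punchOut _))

proposition4p2 : ∀ {c ℓ : Level} (K : CommutativeRing c ℓ) → IsCharZeroField K →
    (m : ℕ) (M : FiniteUnitaryMagma m) →
    NCDual.SpanHasDim m M K (NCDual.relGens m M K) (2 * m ^ 5 ∸ m ^ 4)
proposition4p2 K _ ℕ.zero    M = ⊥-elim (¬Fin0 (FiniteUnitaryMagma.one M))
proposition4p2 K _ (suc n) M =
  subst (SpanHasDim K (relGens K)) (sym dimension≡#Code)
    (supportedOnFibres⇒SpanHasDim (relGens K) gen-supportedOnFibres code↔ gen∈relGens relGens⊆gen)
  where
    open NCDual (suc n) M using (relGens; SpanHasDim)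
    open Relations M
    open Generators K
    open LinearAlgebra K (NCDual.Tree3 (suc n) M) using (supportedOnFibres⇒SpanHasDim)
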